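{- Let $G$ be a directed acyclic graph with $m$ edges, $s$ a vertex, $t$ a sink vertex, and $\varepsilon>0$. For arbitrary initial register values, after $\mathrm{Walk}(G,s,t,\varepsilon)$ terminates every register $R_v$ holds its initial value, i.e., the catalytic tape is unchanged.
   Context: Let $K=\lceil 2m/\varepsilon\rceil$ and $\ell=\lceil\log_2 K\rceil$. The catalytic tape holds one $\ell$-bit register $R_v\in\{0,\dots,2^\ell-1\}$ per vertex $v$, with arbitrary initial content. $d_{\mathrm{out}}(v)$ is the out-degree of $v$ and its out-edges are indexed $0,\dots,d_{\mathrm{out}}(v)-1$. Procedure $\mathrm{WalkOnce}(G,s,\mathrm{mode})$: set $v\gets s$; while $d_{\mathrm{out}}(v)>0$: if mode is Fwd, set $r\gets R_v \bmod d_{\mathrm{out}}(v)$ then $R_v\gets(R_v+1)\bmod 2^\ell$; if mode is Rev, set $R_v\gets (R_v-1)\bmod 2^\ell$ then $r\gets R_v\bmod d_{\mathrm{out}}(v)$; then set $v$ to the endpoint of the $r$-th out-edge of $v$. Return $v$. Procedure $\mathrm{Walk}(G,s,t,\varepsilon)$: forward phase: run $\mathrm{WalkOnce}(G,s,\mathrm{Fwd})$ $K$ times, letting $N_{\mathrm{reach}}$ be the number of runs returning $t$; reverse phase: run $\mathrm{WalkOnce}(G,s,\mathrm{Rev})$ $K$ times; return $N_{\mathrm{reach}}/K$. -}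

module Defs where

open import Data.Nat using (ℕ; zero; suc; _+_; _*_; _∸_; _^_; _%_; _<_; NonZero)
open import Data.Nat.DivMod using (_mod_)
open import Data.Nat.Properties using (m^n≢0)
open import Data.Nat.Logarithm using (⌈log₂_⌉)
open import Data.Fin using (Fin; _≟_)
open import Data.List using (List; []; _∷_; length; lookup; map; allFin)
open import Data.Nat.ListAction using (sum)
open import Relation.Binary.PropositionalEquality using (_≡_)
open import Data.List.Membership.Propositional using (_∈_)
open import Data.Product using (_×_; _,_; proj₁; proj₂)
open import Data.Integer using (∣_∣; +_)
open import Data.Rational using (ℚ; _÷_; Positive; ceiling)
open import Data.Rational.Properties using (pos⇒nonZero)
import Data.Rational as ℚ
open import Relation.Nullary using (¬_; yes; no)

-- A finite directed multigraph on vertex set Fin n.  out v lists the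
-- endpoints of the out-edges of v; the r-th out-edge of v goes to
-- lookup (out v) r.  So d_out(v) = length (out v).
record Graph : Set where
  field
    n   : ℕ
    out : Fin n → List (Fin n)
open Graph public

Vertex : Graph → Set
Vertex G = Fin (n G)

dout : (G : Graph) → Vertex G → ℕ
dout G v = length (out G v)

edges : Graph → ℕ
edges G = sum (map (dout G) (allFin (n G)))

Edge : (G : Graph) → Vertex G → Vertex G → Set
Edge G u w = w ∈ out G u

data Path⁺ (G : Graph) : Vertex G → Vertex G → Set where
  one  : ∀ {u w} → Edge G u w → Path⁺ G u w
  cons : ∀ {u v w} → Edge G u v → Path⁺ G v w → Path⁺ G u w

DAG : Graph → Set
DAG G = ∀ v → ¬ Path⁺ G v v

Sink : (G : Graph) → Vertex G → Set
Sink G t = dout G t ≡ 0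

Kpar : (G : Graph) (ε : ℚ) → .{{_ : Positive ε}} → ℕ
Kpar G ε = ∣ (ceiling (((+ (2 * edges G)) ℚ./ 1 ÷ ε) {{pos⇒nonZero ε}})) ∣

ellpar : (G : Graph) (ε : ℚ) → .{{_ : Positive ε}} → ℕ
ellpar G ε = ⌈log₂ Kpar G ε ⌉

Tape : Graph → Set
Tape G = Vertex G → ℕ

update : {G : Graph} → Tape G → Vertex G → ℕ → Tape G
update R v x w with w ≟ v
... | yes _ = x
... | no  _ = R w

data Mode : Set where
  Fwd Rev : Mode

incr : ℕ → ℕ → ℕ
incr ℓ x = (x + 1) % (2 ^ ℓ)
  where instance _ = m^n≢0 2 ℓ

decr : ℕ → ℕ → ℕ
decr ℓ x = (x + (2 ^ ℓ ∸ 1)) % (2 ^ ℓ)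
  where instance _ = m^n≢0 2 ℓ

-- WalkOnce with a fuel bound (fuel = number of vertices suffices on a DAG,
-- since every walk visits distinct vertices). Returns (final tape, endpoint).
walkOnceF : (G : Graph) → ℕ → Mode → ℕ → Tape G → Vertex G → Tape G × Vertex G
walkOnceF G ℓ md zero R v = R , v
walkOnceF G ℓ md (suc f) R v with out G v
... | [] = R , v
... | es@(_ ∷ _) with md
...   | Fwd = walkOnceF G ℓ md f (update {G} R v (incr ℓ (R v))) (lookup es (R v mod length es))
...   | Rev = walkOnceF G ℓ md f (update {G} R v (decr ℓ (R v))) (lookup es (decr ℓ (R v) mod length es))

walkOnce : (G : Graph) → ℕ → Mode → Tape G → Vertex G → Tape G × Vertex G
walkOnce G ℓ md R s = walkOnceF G ℓ md (n G) R s

fwdPhase : (G : Graph) → ℕ → Vertex G → Vertex G → ℕ → Tape G → ℕ × Tape G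
fwdPhase G ℓ s t zero R = 0 , R
fwdPhase G ℓ s t (suc k) R with walkOnce G ℓ Fwd R s
... | R′ , v with fwdPhase G ℓ s t k R′ | v ≟ t
...   | N , R″ | yes _ = suc N , R″
...   | N , R″ | no  _ = N , R″

revPhase : (G : Graph) → ℕ → Vertex G → ℕ → Tape G → Tape G
revPhase G ℓ s zero R = R
revPhase G ℓ s (suc k) R = revPhase G ℓ s k (proj₁ (walkOnce G ℓ Rev R s))

-- Walk(G,s,t,ε): returns (N_reach, K, final tape); the output value is N_reach/K.
record WalkResult (G : Graph) : Set where
  field
    nReach : ℕ
    kRuns  : ℕ
    tape   : Tape G
open WalkResult public

walk : (G : Graph) → Vertex G → Vertex G → (ε : ℚ) → .{{_ : Positive ε}} → Tape G → WalkResult G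
walk G s t ε R =
  let K = Kpar G ε
      ℓ = ellpar G ε
      fw = fwdPhase G ℓ s t K R
  in record { nReach = proj₁ fw ; kRuns = K ; tape = revPhase G ℓ s K (proj₂ fw) }

{-# OPTIONS --safe #-}

-- On a DAG a forward walk never returns to a vertex it has left, so after leaving v the
-- register R_v keeps the value incr R_v. A reverse walk from the same start decrements it
-- back to R_v (this is where R_v < 2^ℓ is needed), selects the same out-edge, and so
-- retraces the forward path restoring every register. Thus each reverse run undoes the
-- latest forward run, and the K reverse runs undo the K forward runs.

module Submission where

open import Defs
open import Data.Nat using (ℕ; zero; suc; _+_; _∸_; _%_; _<_; _^_; NonZero)
open import Data.Rational using (ℚ; Positive)
open import Data.Nat.Properties using (m^n≢0; m^n>0; m+[n∸m]≡n; +-assoc)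
open import Data.Nat.DivMod using (m%n<n; m<n⇒m%n≡m; [m+n]%n≡m%n; %-distribˡ-+; m%n%n≡m%n; _mod_)
open import Data.Nat.GeneralisedArithmetic using (iterate; iterate-is-fold)
open import Data.Fin using (_≟_)
open import Data.List using (List; []; _∷_; length; lookup)
open import Data.List.Membership.Propositional.Properties using (∈-lookup)
open import Data.Product using (proj₁; proj₂)
open import Relation.Binary.Construct.Closure.ReflexiveTransitive as Star using (Star; _◅_)
open import Function using (_∘_)
open import Relation.Nullary using (¬_; Dec; yes; no; contradiction)
open import Relation.Binary.PropositionalEquality
  using (_≡_; _≢_; _≗_; refl; sym; trans; cong; module ≡-Reasoning)

open ≡-Reasoning

[m%n+k]%n≡[m+k]%n : ∀ m k n .{{_ : NonZero n}} → (m % n + k) % n ≡ (m + k) % n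
[m%n+k]%n≡[m+k]%n m k n = begin
  (m % n + k) % n          ≡⟨ %-distribˡ-+ (m % n) k n ⟩
  (m % n % n + k % n) % n  ≡⟨ cong (λ a → (a + k % n) % n) (m%n%n≡m%n m n) ⟩
  (m % n + k % n) % n      ≡⟨ %-distribˡ-+ m k n ⟨
  (m + k) % n              ∎

module _ (ℓ : ℕ) where

  private instance
    2^ℓ≢0 : NonZero (2 ^ ℓ)
    2^ℓ≢0 = m^n≢0 2 ℓ

  decr-incr : ∀ {x} → x < 2 ^ ℓ → decr ℓ (incr ℓ x) ≡ x
  decr-incr {x} x<2^ℓ = begin
    ((x + 1) % 2 ^ ℓ + (2 ^ ℓ ∸ 1)) % 2 ^ ℓ  ≡⟨ [m%n+k]%n≡[m+k]%n (x + 1) (2 ^ ℓ ∸ 1) (2 ^ ℓ) ⟩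
    (x + 1 + (2 ^ ℓ ∸ 1)) % 2 ^ ℓ            ≡⟨ cong (_% 2 ^ ℓ) (+-assoc x 1 (2 ^ ℓ ∸ 1)) ⟩
    (x + (1 + (2 ^ ℓ ∸ 1))) % 2 ^ ℓ          ≡⟨ cong (λ k → (x + k) % 2 ^ ℓ) (m+[n∸m]≡n (m^n>0 2 ℓ)) ⟩
    (x + 2 ^ ℓ) % 2 ^ ℓ                      ≡⟨ [m+n]%n≡m%n x (2 ^ ℓ) ⟩
    x % 2 ^ ℓ                                ≡⟨ m<n⇒m%n≡m x<2^ℓ ⟩
    x                                        ∎

  -- A step at v in mode md writes written md (R v) to R_v and takes the out-edge
  -- indexed by selector md (R v): Fwd reads before incrementing, Rev after decrementing.
  written : Mode → ℕ → ℕ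
  written Fwd = incr ℓ
  written Rev = decr ℓ

  selector : Mode → ℕ → ℕ
  selector Fwd x = x
  selector Rev = decr ℓ

  written< : ∀ md x → written md x < 2 ^ ℓ
  written< Fwd x = m%n<n (x + 1) (2 ^ ℓ)
  written< Rev x = m%n<n (x + (2 ^ ℓ ∸ 1)) (2 ^ ℓ)

module _ {a} {A : Set a} where

  iterate-suc : ∀ (f : A → A) x k → iterate f x (suc k) ≡ f (iterate f x k)
  iterate-suc f x k = trans (sym (iterate-is-fold x f (suc k))) (cong f (iterate-is-fold x f k))

  iterate-preserves : ∀ {p} (P : A → Set p) {f : A → A} → (∀ x → P x → P (f x)) → ∀ k x → P x → P (iterate f x k)
  iterate-preserves P f-pres zero x px = px
  iterate-preserves P f-pres (suc k) x px = iterate-preserves P f-pres k _ (f-pres x px)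

module _ {a b} {X : Set a} {Y : Set b} where

  iterate-cong : ∀ {g : (X → Y) → X → Y} → (∀ {R S} → R ≗ S → g R ≗ g S) →
                 ∀ k {R S} → R ≗ S → iterate g R k ≗ iterate g S k
  iterate-cong g-cong zero R≗S = R≗S
  iterate-cong g-cong (suc k) R≗S = iterate-cong g-cong k (g-cong R≗S)

  iterate-leftInverse : ∀ {p} (P : (X → Y) → Set p) (f g : (X → Y) → X → Y) →
                        (∀ R → P R → P (f R)) → (∀ R → P R → g (f R) ≗ R) → (∀ {R S} → R ≗ S → g R ≗ g S) →
                        ∀ k R → P R → iterate g (iterate f R k) k ≗ R
  iterate-leftInverse P f g f-pres g∘f g-cong zero R pR x = refl
  iterate-leftInverse P f g f-pres g∘f g-cong (suc k) R pR x = begin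
    iterate g (g (iterate f (f R) k)) k x  ≡⟨ cong (λ S → iterate g (g S) k x) (iterate-suc f R k) ⟩
    iterate g (g (f (iterate f R k))) k x  ≡⟨ iterate-cong g-cong k (g∘f _ (iterate-preserves P f-pres k R pR)) x ⟩
    iterate g (iterate f R k) k x          ≡⟨ iterate-leftInverse P f g f-pres g∘f g-cong k R pR x ⟩
    R x                                    ∎

module _ {G : Graph} where

  infixl 9 _[_≔_]
  _[_≔_] : Tape G → Vertex G → ℕ → Tape G
  R [ v ≔ y ] = update {G} R v y

  update-same : ∀ (R : Tape G) v y → (R [ v ≔ y ]) v ≡ y
  update-same R v y with v ≟ v
  ... | yes _ = refl
  ... | no v≢v = contradiction refl v≢v

  update-other : ∀ (R : Tape G) v y {x} → x ≢ v → (R [ v ≔ y ]) x ≡ R x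
  update-other R v y {x} x≢v with x ≟ v
  ... | yes x≡v = contradiction x≡v x≢v
  ... | no _ = refl

  update-cong : ∀ {R S : Tape G} v y → R ≗ S → R [ v ≔ y ] ≗ S [ v ≔ y ]
  update-cong v y R≗S x with x ≟ v
  ... | yes _ = refl
  ... | no _ = R≗S x

  update-comm : ∀ (R : Tape G) {u v} a b → u ≢ v → R [ u ≔ a ] [ v ≔ b ] ≗ R [ v ≔ b ] [ u ≔ a ]
  update-comm R {u} {v} a b u≢v x = by-cases (x ≟ u) (x ≟ v)
    where
    by-cases : Dec (x ≡ u) → Dec (x ≡ v) → (R [ u ≔ a ] [ v ≔ b ]) x ≡ (R [ v ≔ b ] [ u ≔ a ]) x
    by-cases (yes refl) _ = begin
      (R [ x ≔ a ] [ v ≔ b ]) x  ≡⟨ update-other _ v b u≢v ⟩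
      (R [ x ≔ a ]) x            ≡⟨ update-same R x a ⟩
      a                          ≡⟨ update-same _ x a ⟨
      (R [ v ≔ b ] [ x ≔ a ]) x  ∎
    by-cases (no x≢u) (yes refl) = begin
      (R [ u ≔ a ] [ x ≔ b ]) x  ≡⟨ update-same _ x b ⟩
      b                          ≡⟨ update-same R x b ⟨
      (R [ x ≔ b ]) x            ≡⟨ update-other _ u a x≢u ⟨
      (R [ x ≔ b ] [ u ≔ a ]) x  ∎
    by-cases (no x≢u) (no x≢v) = begin
      (R [ u ≔ a ] [ v ≔ b ]) x  ≡⟨ update-other _ v b x≢v ⟩
      (R [ u ≔ a ]) x            ≡⟨ update-other R u a x≢u ⟩
      R x                        ≡⟨ update-other R v b x≢v ⟨
      (R [ v ≔ b ]) x            ≡⟨ update-other _ u a x≢u ⟨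
      (R [ v ≔ b ] [ u ≔ a ]) x  ∎

  update-restore : ∀ (R : Tape G) v y → R [ v ≔ y ] [ v ≔ R v ] ≗ R
  update-restore R v y x with x ≟ v
  ... | yes refl = refl
  ... | no x≢v = update-other R v y x≢v

  Reachable : Vertex G → Vertex G → Set
  Reachable = Star (Edge G)

  edge◅reachable⇒path⁺ : ∀ {u v w} → Edge G u v → Reachable v w → Path⁺ G u w
  edge◅reachable⇒path⁺ e Star.ε = one e
  edge◅reachable⇒path⁺ e (e′ ◅ r) = cons e (edge◅reachable⇒path⁺ e′ r)

  unreachable⇒≢ : ∀ {u x} → ¬ Reachable u x → x ≢ u
  unreachable⇒≢ u↛x refl = u↛x Star.ε

  choose : (es : List (Vertex G)) .{{_ : NonZero (length es)}} → ℕ → Vertex G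
  choose es r = lookup es (r mod length es)

  choose-edge : ∀ {u es} .{{_ : NonZero (length es)}} → out G u ≡ es → ∀ r → Edge G u (choose es r)
  choose-edge refl r = ∈-lookup _

  module _ (ℓ : ℕ) where

    walkTape : Mode → ℕ → Tape G → Vertex G → Tape G
    walkTape md zero R v = R
    walkTape md (suc f) R v with out G v
    ... | [] = R
    ... | es@(_ ∷ _) = walkTape md f (R [ v ≔ written ℓ md (R v) ]) (choose es (selector ℓ md (R v)))

    walkTape≡walkOnceF : ∀ md f R v → walkTape md f R v ≡ proj₁ (walkOnceF G ℓ md f R v)
    walkTape≡walkOnceF md zero R v = refl
    walkTape≡walkOnceF md (suc f) R v with out G v
    ... | [] = refl
    walkTape≡walkOnceF Fwd (suc f) R v | _ ∷ _ = walkTape≡walkOnceF Fwd f _ _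
    walkTape≡walkOnceF Rev (suc f) R v | _ ∷ _ = walkTape≡walkOnceF Rev f _ _

    walkTape-frame : ∀ md f R u {x} → ¬ Reachable u x → walkTape md f R u x ≡ R x
    walkTape-frame md zero R u u↛x = refl
    walkTape-frame md (suc f) R u u↛x with out G u in eq
    ... | [] = refl
    ... | es@(_ ∷ _) = trans (walkTape-frame md f _ _ (u↛x ∘ (choose-edge eq (selector ℓ md (R u)) ◅_)))
                             (update-other R u _ (unreachable⇒≢ u↛x))

    walkTape-cong : ∀ md f {R S} u → R ≗ S → walkTape md f R u ≗ walkTape md f S u
    walkTape-cong md zero u R≗S = R≗S
    walkTape-cong md (suc f) {R} {S} u R≗S with out G u
    ... | [] = R≗S
    ... | es@(_ ∷ _) rewrite R≗S u = walkTape-cong md f _ (update-cong u _ R≗S)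

    walkTape-update : ∀ md f R u v y → ¬ Reachable u v →
                       walkTape md f (R [ v ≔ y ]) u ≗ walkTape md f R u [ v ≔ y ]
    walkTape-update md zero R u v y u↛v x = refl
    walkTape-update md (suc f) R u v y u↛v x with out G u in eq
    ... | [] = refl
    ... | es@(_ ∷ _) = begin
      walkTape md f (R [ v ≔ y ] [ u ≔ written ℓ md ((R [ v ≔ y ]) u) ])
                     (choose es (selector ℓ md ((R [ v ≔ y ]) u))) x
        ≡⟨ cong (λ r → walkTape md f (R [ v ≔ y ] [ u ≔ written ℓ md r ]) (choose es (selector ℓ md r)) x)
                (update-other R v y u≢v) ⟩
      walkTape md f (R [ v ≔ y ] [ u ≔ w ]) u′ x
        ≡⟨ walkTape-cong md f u′ (update-comm R y w (u≢v ∘ sym)) x ⟩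
      walkTape md f (R [ u ≔ w ] [ v ≔ y ]) u′ x
        ≡⟨ walkTape-update md f (R [ u ≔ w ]) u′ v y (u↛v ∘ (choose-edge eq (selector ℓ md (R u)) ◅_)) x ⟩
      (walkTape md f (R [ u ≔ w ]) u′ [ v ≔ y ]) x  ∎
      where
      u≢v = unreachable⇒≢ u↛v ∘ sym
      w = written ℓ md (R u)
      u′ = choose es (selector ℓ md (R u))

    Bounded : Tape G → Set
    Bounded R = ∀ x → R x < 2 ^ ℓ

    update-bounded : ∀ {R} v {y} → Bounded R → y < 2 ^ ℓ → Bounded (R [ v ≔ y ])
    update-bounded v bR y<2^ℓ x with x ≟ v
    ... | yes _ = y<2^ℓ
    ... | no _ = bR x

    walkTape-bounded : ∀ md f R u → Bounded R → Bounded (walkTape md f R u)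
    walkTape-bounded md zero R u bR = bR
    walkTape-bounded md (suc f) R u bR with out G u
    ... | [] = bR
    ... | _ ∷ _ = walkTape-bounded md f _ _ (update-bounded u bR (written< ℓ md (R u)))

    module _ (dag : DAG G) where

      edge⇒¬reachable-back : ∀ {u v} → Edge G u v → ¬ Reachable v u
      edge⇒¬reachable-back {u} e r = dag u (edge◅reachable⇒path⁺ e r)

      walkTape-Rev-undoes-Fwd : ∀ f R u → Bounded R → walkTape Rev f (walkTape Fwd f R u) u ≗ R
      walkTape-Rev-undoes-Fwd zero R u bR x = refl
      walkTape-Rev-undoes-Fwd (suc f) R u bR x with out G u in eq
      ... | [] = refl
      ... | es@(_ ∷ _) = begin
        walkTape Rev f (R′ [ u ≔ decr ℓ (R′ u) ]) (choose es (decr ℓ (R′ u))) x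
          ≡⟨ cong (λ r → walkTape Rev f (R′ [ u ≔ r ]) (choose es r) x) R′u-restored ⟩
        walkTape Rev f (R′ [ u ≔ R u ]) u′ x
          ≡⟨ walkTape-cong Rev f u′ R′-restored x ⟩
        walkTape Rev f (walkTape Fwd f R u′) u′ x
          ≡⟨ walkTape-Rev-undoes-Fwd f R u′ bR x ⟩
        R x  ∎
        where
        u′ = choose es (R u)
        u′↛u = edge⇒¬reachable-back (choose-edge eq (R u))
        R₁ = R [ u ≔ incr ℓ (R u) ]
        R′ = walkTape Fwd f R₁ u′

        R′u-restored : decr ℓ (R′ u) ≡ R u
        R′u-restored = begin
          decr ℓ (R′ u)             ≡⟨ cong (decr ℓ) (walkTape-frame Fwd f R₁ u′ u′↛u) ⟩
          decr ℓ (R₁ u)             ≡⟨ cong (decr ℓ) (update-same R u _) ⟩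
          decr ℓ (incr ℓ (R u))     ≡⟨ decr-incr ℓ (bR u) ⟩
          R u                       ∎

        R′-restored : R′ [ u ≔ R u ] ≗ walkTape Fwd f R u′
        R′-restored y = begin
          (R′ [ u ≔ R u ]) y                      ≡⟨ walkTape-update Fwd f R₁ u′ u (R u) u′↛u y ⟨
          walkTape Fwd f (R₁ [ u ≔ R u ]) u′ y   ≡⟨ walkTape-cong Fwd f u′ (update-restore R u _) y ⟩
          walkTape Fwd f R u′ y                  ∎

    module _ (s t : Vertex G) where

      run : Mode → Tape G → Tape G
      run md R = walkTape md (n G) R s

      fwdPhase-tape-suc : ∀ k R → proj₂ (fwdPhase G ℓ s t (suc k) R)
                                ≡ proj₂ (fwdPhase G ℓ s t k (proj₁ (walkOnce G ℓ Fwd R s)))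
      fwdPhase-tape-suc k R
        with fwdPhase G ℓ s t k (proj₁ (walkOnce G ℓ Fwd R s)) | proj₂ (walkOnce G ℓ Fwd R s) ≟ t
      ... | _ | yes _ = refl
      ... | _ | no _ = refl

      fwdPhase-tape : ∀ k R → proj₂ (fwdPhase G ℓ s t k R) ≡ iterate (run Fwd) R k
      fwdPhase-tape zero R = refl
      fwdPhase-tape (suc k) R = begin
        proj₂ (fwdPhase G ℓ s t (suc k) R)                        ≡⟨ fwdPhase-tape-suc k R ⟩
        proj₂ (fwdPhase G ℓ s t k (proj₁ (walkOnce G ℓ Fwd R s)))  ≡⟨ cong (proj₂ ∘ fwdPhase G ℓ s t k) (walkTape≡walkOnceF Fwd (n G) R s) ⟨
        proj₂ (fwdPhase G ℓ s t k (run Fwd R))                    ≡⟨ fwdPhase-tape k (run Fwd R) ⟩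
        iterate (run Fwd) (run Fwd R) k                           ∎

      revPhase-iterate : ∀ k R → revPhase G ℓ s k R ≡ iterate (run Rev) R k
      revPhase-iterate zero R = refl
      revPhase-iterate (suc k) R =
        trans (cong (revPhase G ℓ s k) (sym (walkTape≡walkOnceF Rev (n G) R s))) (revPhase-iterate k (run Rev R))

      revPhase-undoes-fwdPhase : DAG G → ∀ k R → Bounded R → revPhase G ℓ s k (proj₂ (fwdPhase G ℓ s t k R)) ≗ R
      revPhase-undoes-fwdPhase dag k R bR x = begin
        revPhase G ℓ s k (proj₂ (fwdPhase G ℓ s t k R)) x  ≡⟨ cong (λ S → revPhase G ℓ s k S x) (fwdPhase-tape k R) ⟩
        revPhase G ℓ s k (iterate (run Fwd) R k) x         ≡⟨ cong (λ S → S x) (revPhase-iterate k _) ⟩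
        iterate (run Rev) (iterate (run Fwd) R k) k x      ≡⟨ iterate-leftInverse Bounded (run Fwd) (run Rev)
                                                                (λ R → walkTape-bounded Fwd (n G) R s)
                                                                (λ R → walkTape-Rev-undoes-Fwd dag (n G) R s)
                                                                (walkTape-cong Rev (n G) s) k R bR x ⟩
        R x                                                ∎

corollary4p7 : (G : Graph) → DAG G → (s t : Vertex G) → Sink G t
    → (ε : ℚ) → .{{_ : Positive ε}}
    → (R : Tape G) → (∀ v → R v < 2 ^ ellpar G ε)
    → ∀ v → tape (walk G s t ε R) v ≡ R v
corollary4p7 G dag s t _ ε R bR = revPhase-undoes-fwdPhase (ellpar G ε) s t dag (Kpar G ε) R bR
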